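{- If $a,b$ are integers with $3\leq a\leq b$, $a$ even, and $b>\frac{3a}{2}-2$, then $n(a,b,4)=a+b+1$.
   Context: A weighted graph (wgraph) is a pair $G=(L,H)$ of simple finite graphs with $V(L)=V(H)$ and $E(L)\cap E(H)=\varnothing$; edges of $L$ are light (weight 1) and edges of $H$ are heavy (weight 2). A wcycle is a cycle (of length at least 3) in the graph with edge set $E(L)\cup E(H)$; its weight is the sum of the weights of its edges. The girth of $G$ is the minimum weight of a wcycle. $G$ is $(a,b)$-regular if $L$ is $a$-regular and $H$ is $b$-regular. An $(a,b,g)$-wgraph is an $(a,b)$-regular wgraph of girth $g$; $n(a,b,g)$ is the minimum order of an $(a,b,g)$-wgraph ($\infty$ if none exists). -}

module Defs where

open import Data.Nat using (ℕ; zero; suc; _+_; _*_; _≤_; _<_)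
open import Data.Bool using (Bool; true; false; if_then_else_; _∨_)
open import Data.Fin using (Fin)
open import Data.List using (List; []; _∷_; length; map; allFin)
open import Data.Nat.ListAction using (sum)
open import Data.List.Relation.Unary.All using (All)
open import Data.List.Relation.Unary.Unique.Propositional using (Unique)
open import Data.Product using (_×_; _,_; Σ; ∃-syntax)
open import Relation.Binary.PropositionalEquality using (_≡_)
open import Relation.Nullary using (¬_)

record WGraph (n : ℕ) : Set where
  field
    L H      : Fin n → Fin n → Bool
    L-sym    : ∀ u v → L u v ≡ L v u
    H-sym    : ∀ u v → H u v ≡ H v u
    L-irrefl : ∀ u → L u u ≡ false
    H-irrefl : ∀ u → H u u ≡ false
    disjoint : ∀ u v → ¬ (L u v ≡ true × H u v ≡ true)

open WGraph public

degree : {n : ℕ} → (Fin n → Fin n → Bool) → Fin n → ℕ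
degree {n} A u = sum (map (λ v → if A u v then 1 else 0) (allFin n))

Regular : {n : ℕ} → ℕ → (Fin n → Fin n → Bool) → Set
Regular k A = ∀ u → degree A u ≡ k

IsRegular : {n : ℕ} → ℕ → ℕ → WGraph n → Set
IsRegular a b G = Regular a (L G) × Regular b (H G)

Adj : {n : ℕ} → WGraph n → Fin n → Fin n → Set
Adj G u v = (L G u v ∨ H G u v) ≡ true

wt : {n : ℕ} → WGraph n → Fin n → Fin n → ℕ
wt G u v = if L G u v then 1 else (if H G u v then 2 else 0)

cycEdges : {A : Set} → List A → List (A × A)
cycEdges [] = []
cycEdges (x ∷ xs) = go (x ∷ xs)
  where
  go : _ → List _
  go [] = []
  go (y ∷ []) = (y , x) ∷ []
  go (y ∷ z ∷ zs) = (y , z) ∷ go (z ∷ zs)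

IsWCycle : {n : ℕ} → WGraph n → List (Fin n) → Set
IsWCycle G vs = (3 ≤ length vs) × Unique vs × All (λ { (u , v) → Adj G u v }) (cycEdges vs)

weight : {n : ℕ} → WGraph n → List (Fin n) → ℕ
weight G vs = sum (map (λ { (u , v) → wt G u v }) (cycEdges vs))

HasGirth : {n : ℕ} → WGraph n → ℕ → Set
HasGirth G g = (∃[ vs ] (IsWCycle G vs × weight G vs ≡ g))
             × (∀ vs → IsWCycle G vs → g ≤ weight G vs)

IsABGWGraph : (a b g : ℕ) {n : ℕ} → WGraph n → Set
IsABGWGraph a b g G = IsRegular a b G × HasGirth G g

MinOrder : (a b g m : ℕ) → Set
MinOrder a b g m =
  (Σ (WGraph m) (IsABGWGraph a b g))
  × (∀ (k : ℕ) (G : WGraph k) → IsABGWGraph a b g G → m ≤ k)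

-- The order bound is counting: each vertex of an (a,b)-regular wgraph has a + b distinct neighbours.
--
-- For the construction, let L be a triangle-free a-regular graph on N = a + b + 1 vertices and let
-- H be its complement. Then H is b-regular. Every wcycle weighs at least 4, because a triangle
-- cannot be all light. Any two light neighbours of a vertex are joined by a heavy edge, and these
-- three edges form a wcycle of weight 1 + 1 + 2. With a = 2k, the condition 3a < 2b + 4 says that
-- N ≥ 5k, and a triangle-free 2k-regular graph exists on every N ≥ 5k vertices:
--  * for N = 5k + w with w ≤ k, blow up C₅ into blocks of sizes k − w, k, k + w, k + w, k. Join
--    consecutive blocks completely, except the two blocks of size z = k + w. Between those two
--    blocks, i ~ j iff (i + j) mod z < k. The blow-up maps homomorphically onto C₅, so it has no
--    triangles;
--  * for N > 6k, take the circulant graph on ℤ_N with jumps ±[d, d + k), where 3d > N. Every edge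
--    joins vertices at distance in [d, N − d], so a triangle x < y < z would give
--    3d ≤ (y − x) + (z − y) + d ≤ N.

{-# OPTIONS --safe #-}
module Submission where

open import Defs
open import Data.Nat using (ℕ; _+_; _*_; _≤_; _<_)
open import Data.Nat.Divisibility using (_∣_)

open import Algebra.Properties.CommutativeSemigroup using (interchange)
open import Data.Bool using (Bool; true; false; if_then_else_; not; _∧_; _∨_)
open import Data.Bool.Properties using (∨-zeroʳ; ∧-zeroʳ)
open import Data.Empty using (⊥; ⊥-elim)
open import Data.Fin using (Fin; toℕ; fromℕ<) renaming (zero to fzero; suc to fsuc)
open import Data.Fin.Properties using (all?; toℕ-fromℕ<; toℕ<n)
open import Data.List using (List; []; _∷_; length; lookup; tabulate)
open import Data.List.Properties using (map-tabulate)
open import Data.List.Relation.Binary.Pointwise using (Pointwise; Pointwise-≡⇒≡; []; _∷_)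
open import Data.List.Relation.Unary.All using ([]; _∷_)
open import Data.List.Relation.Unary.AllPairs using ([]; _∷_)
open import Data.List.Relation.Unary.Unique.Propositional using (Unique)
open import Data.Nat
  using (zero; suc; _∸_; z≤n; s≤s; s≤s⁻¹; z<s; s<s; ∣_-_∣; _≟_; _≤?_; _<?_; NonZero; >-nonZero)
open import Data.Nat.DivMod using (_/_; _%_; m≡m%n+[m/n]*n; m%n<n; m<n⇒m%n≡m; [m+n]%n≡m%n)
open import Data.Nat.Divisibility using (divides)
open import Data.Nat.ListAction using (sum)
open import Data.Nat.Properties
open import Data.Nat.Tactic.RingSolver using (solve-∀)
open import Data.Product using (_×_; _,_; ∃; ∃₂; Σ; proj₁; proj₂; map₁)
open import Data.Sum using (_⊎_; inj₁; inj₂) renaming (swap to ⊎-swap)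
open import Function using (_∘_; id)
open import Function.Bundles using (_⇔_; mk⇔; Equivalence)
open import Relation.Binary.PropositionalEquality
open import Relation.Nullary using (¬_; Dec; yes; no; does; contradiction)
open import Relation.Nullary.Decidable
  using (_×-dec_; _⊎-dec_; _→-dec_; ¬?; dec-true; dec-false; does-⇔; toWitness)

-- Sums over initial segments of ℕ

∑< : ℕ → (ℕ → ℕ) → ℕ
∑< zero    f = 0
∑< (suc n) f = f 0 + ∑< n (f ∘ suc)

syntax ∑< n (λ v → e) = ∑[ v < n ] e

𝟙 : Bool → ℕ
𝟙 b = if b then 1 else 0

∑-cong : ∀ n {f g} → (∀ {v} → v < n → f v ≡ g v) → ∑< n f ≡ ∑< n g
∑-cong zero    f≗g = refl
∑-cong (suc n) f≗g = cong₂ _+_ (f≗g z<s) (∑-cong n (f≗g ∘ s<s))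

∑-zero : ∀ n {f} → (∀ {v} → v < n → f v ≡ 0) → ∑< n f ≡ 0
∑-zero zero    f≗0 = refl
∑-zero (suc n) f≗0 = cong₂ _+_ (f≗0 z<s) (∑-zero n (f≗0 ∘ s<s))

∑-ones : ∀ n {f} → (∀ {v} → v < n → f v ≡ 1) → ∑< n f ≡ n
∑-ones zero    f≗1 = refl
∑-ones (suc n) f≗1 = cong₂ _+_ (f≗1 z<s) (∑-ones n (f≗1 ∘ s<s))

∑-+ : ∀ n f g → ∑[ v < n ] (f v + g v) ≡ ∑< n f + ∑< n g
∑-+ zero    f g = refl
∑-+ (suc n) f g = trans (cong (f 0 + g 0 +_) (∑-+ n (f ∘ suc) (g ∘ suc)))
                        (interchange +-commutativeSemigroup (f 0) (g 0) (∑< n (f ∘ suc)) (∑< n (g ∘ suc)))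

∑-split : ∀ m n f → ∑< (m + n) f ≡ ∑< m f + ∑[ v < n ] f (m + v)
∑-split zero    n f = refl
∑-split (suc m) n f = trans (cong (f 0 +_) (∑-split m n (f ∘ suc))) (sym (+-assoc (f 0) _ _))

𝟙-⊎ : ∀ {P Q : Set} (P? : Dec P) (Q? : Dec Q) → ¬ (P × Q) →
      𝟙 (does (P? ⊎-dec Q?)) ≡ 𝟙 (does P?) + 𝟙 (does Q?)
𝟙-⊎ (yes p) (yes q) ¬p×q = contradiction (p , q) ¬p×q
𝟙-⊎ (yes _) (no _)  _    = refl
𝟙-⊎ (no _)  _       _    = refl

infix 4 _≤_<?_
_≤_<?_ : ∀ lo t hi → Dec (lo ≤ t × t < hi)
lo ≤ t <? hi = (lo ≤? t) ×-dec (t <? hi)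

∑-interval : ∀ {n} lo k → lo + k ≤ n → ∑[ t < n ] 𝟙 (does (lo ≤ t <? lo + k)) ≡ k
∑-interval {n} lo k lo+k≤n with e , refl ← m≤n⇒∃[o]m+o≡n lo+k≤n = begin
  ∑< (lo + k + e) f                          ≡⟨ ∑-split (lo + k) e f ⟩
  ∑< (lo + k) f + ∑[ j < e ] f (lo + k + j)  ≡⟨ cong₂ _+_ (∑-split lo k f) (∑-zero e after) ⟩
  ∑< lo f + ∑[ j < k ] f (lo + j) + 0        ≡⟨ cong₂ (λ m n → m + n + 0) (∑-zero lo before)
                                                                          (∑-ones k inside) ⟩
  k + 0                                      ≡⟨ +-identityʳ k ⟩
  k                                          ∎
  where
  open ≡-Reasoning
  f : ℕ → ℕ
  f t = 𝟙 (does (lo ≤ t <? lo + k))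
  before : ∀ {t} → t < lo → f t ≡ 0
  before t<lo = cong 𝟙 (dec-false (lo ≤ _ <? lo + k) λ (lo≤t , _) → <⇒≱ t<lo lo≤t)
  inside : ∀ {j} → j < k → f (lo + j) ≡ 1
  inside j<k = cong 𝟙 (dec-true (lo ≤ _ <? lo + k) (m≤m+n lo _ , +-monoʳ-< lo j<k))
  after : ∀ {j} → j < e → f (lo + k + j) ≡ 0
  after _ = cong 𝟙 (dec-false (lo ≤ _ <? lo + k) λ (_ , lt) → m+n≮m (lo + k) _ lt)

∑-rotate : ∀ z .{{_ : NonZero z}} {i} f → i ≤ z → ∑[ j < z ] f ((i + j) % z) ≡ ∑< z f
∑-rotate z {i} f i≤z with e , refl ← m≤n⇒∃[o]m+o≡n i≤z = begin
  ∑[ j < i + e ] f ((i + j) % (i + e))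
    ≡⟨ cong (λ n → ∑[ j < n ] f ((i + j) % (i + e))) (+-comm i e) ⟩
  ∑[ j < e + i ] f ((i + j) % (i + e))
    ≡⟨ ∑-split e i _ ⟩
  ∑[ j < e ] f ((i + j) % (i + e)) + ∑[ s < i ] f ((i + (e + s)) % (i + e))
    ≡⟨ cong₂ _+_ (∑-cong e (cong f ∘ no-wrap)) (∑-cong i (cong f ∘ wrap)) ⟩
  ∑[ j < e ] f (i + j) + ∑< i f
    ≡⟨ +-comm _ (∑< i f) ⟩
  ∑< i f + ∑[ j < e ] f (i + j)
    ≡⟨ ∑-split i e f ⟨
  ∑< (i + e) f ∎
  where
  open ≡-Reasoning
  no-wrap : ∀ {j} → j < e → (i + j) % (i + e) ≡ i + j
  no-wrap j<e = m<n⇒m%n≡m (+-monoʳ-< i j<e)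
  wrap : ∀ {s} → s < i → (i + (e + s)) % (i + e) ≡ s
  wrap {s} s<i = begin
    (i + (e + s)) % (i + e) ≡⟨ cong (_% (i + e)) (trans (sym (+-assoc i e s)) (+-comm (i + e) s)) ⟩
    (s + (i + e)) % (i + e) ≡⟨ [m+n]%n≡m%n s (i + e) ⟩
    s % (i + e)             ≡⟨ m<n⇒m%n≡m (<-≤-trans s<i (m≤m+n i e)) ⟩
    s                       ∎

∑-reflect : ∀ {N} u g → u ≤ N → (∀ {s t} → s + t ≡ N → g s ≡ g t) →
            ∑[ v < N ] g ∣ u - v ∣ ≡ ∑< N g
∑-reflect u g u≤N g-reflect with e , refl ← m≤n⇒∃[o]m+o≡n u≤N = begin
  ∑[ v < u + e ] g ∣ u - v ∣
    ≡⟨ ∑-split u e _ ⟩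
  ∑[ v < u ] g ∣ u - v ∣ + ∑[ t < e ] g ∣ u - u + t ∣
    ≡⟨ cong₂ _+_ (∑-cong u reflected) (∑-cong e λ {t} _ → cong g (∣m-m+n∣≡n u t)) ⟩
  ∑[ v < u ] g (e + v) + ∑< e g
    ≡⟨ +-comm _ (∑< e g) ⟩
  ∑< e g + ∑[ v < u ] g (e + v)
    ≡⟨ ∑-split e u g ⟨
  ∑< (e + u) g
    ≡⟨ cong (λ n → ∑< n g) (+-comm e u) ⟩
  ∑< (u + e) g ∎
  where
  open ≡-Reasoning
  reflected : ∀ {v} → v < u → g ∣ u - v ∣ ≡ g (e + v)
  reflected {v} v<u = begin
    g ∣ u - v ∣ ≡⟨ cong g (m≤n⇒∣n-m∣≡n∸m (<⇒≤ v<u)) ⟩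
    g (u ∸ v)   ≡⟨ g-reflect (begin
                     u ∸ v + (e + v)   ≡⟨ +-comm (u ∸ v) (e + v) ⟩
                     e + v + (u ∸ v)   ≡⟨ +-assoc e v (u ∸ v) ⟩
                     e + (v + (u ∸ v)) ≡⟨ cong (e +_) (m+[n∸m]≡n (<⇒≤ v<u)) ⟩
                     e + u             ≡⟨ +-comm e u ⟩
                     u + e             ∎) ⟩
    g (e + v)   ∎

∑-≥1⇒∃ : ∀ n {P : ℕ → Set} (P? : ∀ v → Dec (P v)) → 1 ≤ ∑[ v < n ] 𝟙 (does (P? v)) →
         ∃ λ v → v < n × P v
∑-≥1⇒∃ (suc n) P? h with P? 0
... | yes p0 = 0 , z<s , p0
... | no _   with v , v<n , pv ← ∑-≥1⇒∃ n (P? ∘ suc) h = suc v , s<s v<n , pv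

∑-≥2⇒∃₂ : ∀ n {P : ℕ → Set} (P? : ∀ v → Dec (P v)) → 2 ≤ ∑[ v < n ] 𝟙 (does (P? v)) →
          ∃₂ λ v w → v < w × w < n × P v × P w
∑-≥2⇒∃₂ (suc n) P? h with P? 0
... | yes p0 with w , w<n , pw ← ∑-≥1⇒∃ n (P? ∘ suc) (s≤s⁻¹ h) =
  0 , suc w , z<s , s<s w<n , p0 , pw
... | no _   with v , w , v<w , w<n , pv , pw ← ∑-≥2⇒∃₂ n (P? ∘ suc) h =
  suc v , suc w , s<s v<w , s<s w<n , pv , pw

∑-point : ∀ n {u} → u < n → ∑[ v < n ] 𝟙 (does (u ≟ v)) ≡ 1
∑-point (suc n) {zero}  _         = cong suc (∑-zero n λ _ → refl)
∑-point (suc n) {suc u} (s<s u<n) = ∑-point n u<n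

-- Degrees and weights in wgraphs

sum-tabulate-+ : ∀ {n} (f g : Fin n → ℕ) →
                 sum (tabulate (λ v → f v + g v)) ≡ sum (tabulate f) + sum (tabulate g)
sum-tabulate-+ {zero}  f g = refl
sum-tabulate-+ {suc n} f g =
  trans (cong (f fzero + g fzero +_) (sum-tabulate-+ (f ∘ fsuc) (g ∘ fsuc)))
        (interchange +-commutativeSemigroup (f fzero) (g fzero) _ _)

sum-tabulate-≤ : ∀ {n} (f : Fin n → ℕ) → (∀ v → f v ≤ 1) → sum (tabulate f) ≤ n
sum-tabulate-≤ {zero}  f f≤1 = z≤n
sum-tabulate-≤ {suc n} f f≤1 = +-mono-≤ (f≤1 fzero) (sum-tabulate-≤ (f ∘ fsuc) (f≤1 ∘ fsuc))

sum-tabulate-< : ∀ {n} (f : Fin n → ℕ) → (∀ v → f v ≤ 1) → ∀ u → f u ≡ 0 → sum (tabulate f) < n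
sum-tabulate-< {suc n} f f≤1 fzero    fu≡0 rewrite fu≡0 = s≤s (sum-tabulate-≤ (f ∘ fsuc) (f≤1 ∘ fsuc))
sum-tabulate-< {suc n} f f≤1 (fsuc u) fu≡0 = begin
  suc (f fzero + sum (tabulate (f ∘ fsuc))) ≡⟨ +-suc (f fzero) _ ⟨
  f fzero + suc (sum (tabulate (f ∘ fsuc))) ≤⟨ +-mono-≤ (f≤1 fzero)
                                                         (sum-tabulate-< (f ∘ fsuc) (f≤1 ∘ fsuc) u fu≡0) ⟩
  suc n                                     ∎
  where open ≤-Reasoning

degree-tabulate : ∀ {n} (A : Fin n → Fin n → Bool) u → degree A u ≡ sum (tabulate (λ v → 𝟙 (A u v)))
degree-tabulate A u = cong sum (map-tabulate id (λ v → 𝟙 (A u v)))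

degree-∑ : ∀ {n} (A : ℕ → ℕ → Bool) (u : Fin n) →
           degree (λ u v → A (toℕ u) (toℕ v)) u ≡ ∑[ v < n ] 𝟙 (A (toℕ u) v)
degree-∑ {n} A u = trans (degree-tabulate (λ u v → A (toℕ u) (toℕ v)) u) (sum-tabulate-toℕ n)
  where
  sum-tabulate-toℕ : ∀ m {f : ℕ → ℕ} → sum (tabulate {n = m} (f ∘ toℕ)) ≡ ∑< m f
  sum-tabulate-toℕ zero    = refl
  sum-tabulate-toℕ (suc m) = cong (_ +_) (sum-tabulate-toℕ m)

𝟙-disjoint : ∀ x y → ¬ (x ≡ true × y ≡ true) → 𝟙 x + 𝟙 y ≤ 1
𝟙-disjoint true  true  ¬both = contradiction (refl , refl) ¬both
𝟙-disjoint true  false _     = ≤-refl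
𝟙-disjoint false true  _     = ≤-refl
𝟙-disjoint false false _     = z≤n

𝟙-partition : ∀ l e → (l ≡ true → e ≡ true → ⊥) → 𝟙 (not l ∧ not e) + 𝟙 l + 𝟙 e ≡ 1
𝟙-partition true  true  both = ⊥-elim (both refl refl)
𝟙-partition true  false _    = refl
𝟙-partition false true  _    = refl
𝟙-partition false false _    = refl

dec-true⁻¹ : ∀ {P : Set} (P? : Dec P) → does P? ≡ true → P
dec-true⁻¹ (yes p) _ = p

IsRegular⇒a+b+1≤n : ∀ {a b n} (G : WGraph n) → IsRegular a b G → Fin n → a + b + 1 ≤ n
IsRegular⇒a+b+1≤n {a} {b} {n} G (L-regular , H-regular) u = begin
  a + b + 1                             ≡⟨ +-comm (a + b) 1 ⟩
  suc (a + b)                           ≡⟨ cong suc (cong₂ _+_ (L-regular u) (H-regular u)) ⟨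
  suc (degree (L G) u + degree (H G) u) ≡⟨ cong suc (cong₂ _+_ (degree-tabulate (L G) u)
                                                                (degree-tabulate (H G) u)) ⟩
  suc (sum (tabulate (𝟙 ∘ L G u)) + sum (tabulate (𝟙 ∘ H G u)))
                                        ≡⟨ cong suc (sum-tabulate-+ (𝟙 ∘ L G u) (𝟙 ∘ H G u)) ⟨
  suc (sum (tabulate neighbour))        ≤⟨ sum-tabulate-< neighbour (λ v → 𝟙-disjoint _ _ (disjoint G u v)) u
                                             (cong₂ (λ l h → 𝟙 l + 𝟙 h) (L-irrefl G u) (H-irrefl G u)) ⟩
  n                                     ∎
  where
  open ≤-Reasoning
  neighbour : Fin n → ℕ
  neighbour v = 𝟙 (L G u v) + 𝟙 (H G u v)

IsABGWGraph⇒a+b+1≤n : ∀ {a b g n} (G : WGraph n) → IsABGWGraph a b g G → a + b + 1 ≤ n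
IsABGWGraph⇒a+b+1≤n G (regular , (v ∷ _ , _) , _) = IsRegular⇒a+b+1≤n G regular v

module _ {n} (G : WGraph n) where

  Adj-light : ∀ {u v} → L G u v ≡ true → Adj G u v
  Adj-light l = cong (_∨ H G _ _) l

  Adj-heavy : ∀ {u v} → H G u v ≡ true → Adj G u v
  Adj-heavy {u} {v} h = trans (cong (L G u v ∨_) h) (∨-zeroʳ (L G u v))

  Adj⇒≢ : ∀ {u v} → Adj G u v → u ≢ v
  Adj⇒≢ {u} adj refl rewrite L-irrefl G u | H-irrefl G u = contradiction adj λ ()

  wt-light : ∀ {u v} → L G u v ≡ true → wt G u v ≡ 1
  wt-light l rewrite l = refl

  wt-heavy : ∀ {u v} → H G u v ≡ true → wt G u v ≡ 2
  wt-heavy {u} {v} h with L G u v in l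
  ... | true  = contradiction (l , h) (disjoint G u v)
  ... | false rewrite h = refl

  light-or-heavy : ∀ {u v} → Adj G u v → L G u v ≡ true ⊎ wt G u v ≡ 2
  light-or-heavy {u} {v} adj with L G u v in l | H G u v in h
  ... | true  | _    = inj₁ refl
  ... | false | true = inj₂ refl
  light-or-heavy {u} {v} () | false | false

  1≤wt : ∀ {u v} → Adj G u v → 1 ≤ wt G u v
  1≤wt adj with light-or-heavy adj
  ... | inj₁ l = ≤-reflexive (sym (wt-light l))
  ... | inj₂ h = ≤-trans (s≤s z≤n) (≤-reflexive (sym h))

  4≤weight : (∀ {u v w} → L G u v ≡ true → L G v w ≡ true → L G w u ≡ true → ⊥) →
             ∀ vs → IsWCycle G vs → 4 ≤ weight G vs
  4≤weight L-triangle-free (p ∷ q ∷ r ∷ []) (_ , _ , pq ∷ qr ∷ rp ∷ [])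
    with light-or-heavy pq | light-or-heavy qr | light-or-heavy rp
  ... | inj₁ l₁ | inj₁ l₂ | inj₁ l₃ = ⊥-elim (L-triangle-free l₁ l₂ l₃)
  ... | inj₂ h₁ | _       | _       =
    +-mono-≤ (≤-reflexive (sym h₁)) (+-mono-≤ (1≤wt qr) (+-mono-≤ (1≤wt rp) z≤n))
  ... | _       | inj₂ h₂ | _       =
    +-mono-≤ (1≤wt pq) (+-mono-≤ (≤-reflexive (sym h₂)) (+-mono-≤ (1≤wt rp) z≤n))
  ... | _       | _       | inj₂ h₃ =
    +-mono-≤ (1≤wt pq) (+-mono-≤ (1≤wt qr) (+-mono-≤ (≤-reflexive (sym h₃)) z≤n))
  4≤weight _ (_ ∷ []) (s≤s () , _)
  4≤weight _ (_ ∷ _ ∷ []) (s≤s (s≤s ()) , _)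
  4≤weight _ (p ∷ q ∷ r ∷ s ∷ []) (_ , _ , pq ∷ qr ∷ rs ∷ sp ∷ []) =
    +-mono-≤ (1≤wt pq) (+-mono-≤ (1≤wt qr) (+-mono-≤ (1≤wt rs) (+-mono-≤ (1≤wt sp) z≤n)))
  4≤weight _ (p ∷ q ∷ r ∷ s ∷ t ∷ _) (_ , _ , pq ∷ qr ∷ rs ∷ st ∷ _) =
    +-mono-≤ (1≤wt pq) (+-mono-≤ (1≤wt qr) (+-mono-≤ (1≤wt rs) (+-mono-≤ (1≤wt st) z≤n)))

  light-light-heavy-wcycle : ∀ {u v w} → L G v u ≡ true → L G u w ≡ true → H G w v ≡ true →
                             IsWCycle G (v ∷ u ∷ w ∷ []) × weight G (v ∷ u ∷ w ∷ []) ≡ 4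
  light-light-heavy-wcycle {u} {v} {w} vu uw wv =
    (s≤s (s≤s (s≤s z≤n)) , distinct , Adj-light vu ∷ Adj-light uw ∷ Adj-heavy wv ∷ []) , weight≡4
    where
    distinct : Unique (v ∷ u ∷ w ∷ [])
    distinct = (Adj⇒≢ (Adj-light vu) ∷ ≢-sym (Adj⇒≢ (Adj-heavy wv)) ∷ [])
             ∷ (Adj⇒≢ (Adj-light uw) ∷ [])
             ∷ []
             ∷ []
    weight≡4 : weight G (v ∷ u ∷ w ∷ []) ≡ 4
    weight≡4 rewrite wt-light vu | wt-light uw | wt-heavy wv = refl

-- Triangle-free regular graphs and their complements

record TriangleFreeRegularGraph (N a : ℕ) : Set₁ where
  field
    _~_           : ℕ → ℕ → Set
    _~?_          : ∀ u v → Dec (u ~ v)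
    ~-sym         : ∀ {u v} → u ~ v → v ~ u
    ~-irrefl      : ∀ {u} → ¬ u ~ u
    triangle-free : ∀ {u v w} → u < N → v < N → w < N → u ~ v → v ~ w → w ~ u → ⊥
    regular       : ∀ {u} → u < N → ∑[ v < N ] 𝟙 (does (u ~? v)) ≡ a

module Complement {a b} (Γ : TriangleFreeRegularGraph (a + b + 1) a) where
  open TriangleFreeRegularGraph Γ

  N : ℕ
  N = a + b + 1

  light heavy : Fin N → Fin N → Bool
  light u v = does (toℕ u ~? toℕ v)
  heavy u v = not (light u v) ∧ not (does (toℕ u ≟ toℕ v))

  light-sym : ∀ u v → light u v ≡ light v u
  light-sym u v = does-⇔ (mk⇔ ~-sym ~-sym) (_ ~? _) (_ ~? _)

  wgraph : WGraph N
  wgraph = record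
    { L        = light
    ; H        = heavy
    ; L-sym    = light-sym
    ; H-sym    = λ u v → cong₂ (λ l e → not l ∧ not e) (light-sym u v)
                                (does-⇔ (mk⇔ sym sym) (toℕ u ≟ toℕ v) (toℕ v ≟ toℕ u))
    ; L-irrefl = λ u → dec-false (_ ~? _) ~-irrefl
    ; H-irrefl = λ u → trans (cong (λ e → not (light u u) ∧ not e) (dec-true (toℕ u ≟ toℕ u) refl))
                             (∧-zeroʳ _)
    ; disjoint = λ u v (l , h) →
        contradiction (trans (cong (λ l → not l ∧ not (does (toℕ u ≟ toℕ v))) (sym l)) h) λ ()
    }

  light-regular : Regular a light
  light-regular u = trans (degree-∑ (λ u v → does (u ~? v)) u) (regular (toℕ<n u))

  heavy-regular : Regular b heavy
  heavy-regular u = +-cancelʳ-≡ (a + 1) _ _ (begin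
    degree heavy u + (a + 1)
      ≡⟨ cong₂ _+_ (degree-∑ (λ u v → not (does (u ~? v)) ∧ not (does (u ≟ v))) u)
                   (sym (cong₂ _+_ (regular (toℕ<n u)) (∑-point N (toℕ<n u)))) ⟩
    ∑< N h + (∑< N l + ∑< N e)          ≡⟨ +-assoc (∑< N h) _ _ ⟨
    ∑< N h + ∑< N l + ∑< N e            ≡⟨ cong (_+ ∑< N e) (∑-+ N h l) ⟨
    ∑< N (λ v → h v + l v) + ∑< N e     ≡⟨ ∑-+ N (λ v → h v + l v) e ⟨
    ∑[ v < N ] (h v + l v + e v)        ≡⟨ ∑-ones N (λ {v} _ → partition v) ⟩
    a + b + 1                           ≡⟨ cong (_+ 1) (+-comm a b) ⟩
    b + a + 1                           ≡⟨ +-assoc b a 1 ⟩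
    b + (a + 1)                         ∎)
    where
    open ≡-Reasoning
    h l e : ℕ → ℕ
    h v = 𝟙 (not (does (toℕ u ~? v)) ∧ not (does (toℕ u ≟ v)))
    l v = 𝟙 (does (toℕ u ~? v))
    e v = 𝟙 (does (toℕ u ≟ v))
    partition : ∀ v → h v + l v + e v ≡ 1
    partition v = 𝟙-partition _ _ λ l e →
      ~-irrefl (subst (toℕ u ~_) (sym (dec-true⁻¹ (_ ≟ _) e)) (dec-true⁻¹ (_ ~? _) l))

  light-fromℕ< : ∀ {u v} (u<N : u < N) (v<N : v < N) → u ~ v → light (fromℕ< u<N) (fromℕ< v<N) ≡ true
  light-fromℕ< u<N v<N u~v rewrite toℕ-fromℕ< u<N | toℕ-fromℕ< v<N = dec-true (_ ~? _) u~v

  heavy-fromℕ< : ∀ {u v} (u<N : u < N) (v<N : v < N) → ¬ u ~ v → u ≢ v →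
                 heavy (fromℕ< u<N) (fromℕ< v<N) ≡ true
  heavy-fromℕ< {u} {v} u<N v<N u≁v u≢v
    rewrite toℕ-fromℕ< u<N | toℕ-fromℕ< v<N | dec-false (u ~? v) u≁v | dec-false (u ≟ v) u≢v = refl

  light-triangle-free : ∀ {u v w} → light u v ≡ true → light v w ≡ true → light w u ≡ true → ⊥
  light-triangle-free {u} {v} {w} uv vw wu = triangle-free (toℕ<n u) (toℕ<n v) (toℕ<n w)
    (dec-true⁻¹ (_ ~? _) uv) (dec-true⁻¹ (_ ~? _) vw) (dec-true⁻¹ (_ ~? _) wu)

  0<N : 0 < N
  0<N = m≤n+m 1 (a + b)

  girth-4 : 2 ≤ a → HasGirth wgraph 4
  girth-4 2≤a
    with v , w , v<w , w<N , 0~v , 0~w ← ∑-≥2⇒∃₂ N (0 ~?_) (subst (2 ≤_) (sym (regular 0<N)) 2≤a) =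
    (_ , light-light-heavy-wcycle wgraph (light-fromℕ< v<N 0<N (~-sym 0~v)) (light-fromℕ< 0<N w<N 0~w)
                                         (heavy-fromℕ< w<N v<N w≁v (>⇒≢ v<w)))
    , 4≤weight wgraph light-triangle-free
    where
    v<N = <-trans v<w w<N
    w≁v = λ w~v → triangle-free v<N 0<N w<N (~-sym 0~v) 0~w w~v

  abg-wgraph : 2 ≤ a → Σ (WGraph N) (IsABGWGraph a b 4)
  abg-wgraph 2≤a = wgraph , (light-regular , heavy-regular) , girth-4 2≤a

-- Blow-up of C₅

locate : List ℕ → ℕ → ℕ × ℕ
locate []       v = 0 , v
locate (n ∷ ns) v = if does (v <? n) then (0 , v) else map₁ suc (locate ns (v ∸ n))

locate-here : ∀ {n} ns {v} → v < n → locate (n ∷ ns) v ≡ (0 , v)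
locate-here _ v<n rewrite dec-true (_ <? _) v<n = refl

locate-there : ∀ {n} ns {v} → ¬ v < n → locate (n ∷ ns) v ≡ map₁ suc (locate ns (v ∸ n))
locate-there _ v≮n rewrite dec-false (_ <? _) v≮n = refl

locate-< : ∀ ns {v} → v < sum ns →
           ∃ λ (p : Fin (length ns)) → ∃ λ i → i < lookup ns p × locate ns v ≡ (toℕ p , i)
locate-< (n ∷ ns) {v} v<sum with v <? n
... | yes v<n = fzero , v , v<n , locate-here ns v<n
... | no v≮n
  with p , i , i< , ≡p,i ← locate-< ns (subst (v ∸ n <_) (m+n∸m≡n n (sum ns))
                                               (∸-monoˡ-< v<sum (≮⇒≥ v≮n))) =
  fsuc p , i , i< , trans (locate-there ns v≮n) (cong (map₁ suc) ≡p,i)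

blockSums : List ℕ → (ℕ × ℕ → ℕ) → List ℕ
blockSums []       f = []
blockSums (n ∷ ns) f = ∑[ j < n ] f (0 , j) ∷ blockSums ns (f ∘ map₁ suc)

∑-locate : ∀ ns f → ∑[ v < sum ns ] f (locate ns v) ≡ sum (blockSums ns f)
∑-locate []       f = refl
∑-locate (n ∷ ns) f = begin
  ∑[ v < n + sum ns ] f (locate (n ∷ ns) v)
    ≡⟨ ∑-split n (sum ns) _ ⟩
  ∑[ v < n ] f (locate (n ∷ ns) v) + ∑[ v < sum ns ] f (locate (n ∷ ns) (n + v))
    ≡⟨ cong₂ _+_ (∑-cong n (cong f ∘ locate-here ns)) (∑-cong (sum ns) λ {v} _ → cong f (there v)) ⟩
  ∑[ j < n ] f (0 , j) + ∑[ v < sum ns ] f (map₁ suc (locate ns v))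
    ≡⟨ cong (_ +_) (∑-locate ns (f ∘ map₁ suc)) ⟩
  sum (blockSums (n ∷ ns) f) ∎
  where
  open ≡-Reasoning
  there : ∀ v → locate (n ∷ ns) (n + v) ≡ map₁ suc (locate ns v)
  there v = trans (locate-there ns (m+n≮m n v)) (cong (map₁ suc ∘ locate ns) (m+n∸m≡n n v))

C₅ : ℕ → ℕ → Set
C₅ p q = ∣ p - q ∣ ≡ 1 ⊎ ∣ p - q ∣ ≡ 4

C₅? : ∀ p q → Dec (C₅ p q)
C₅? p q = (∣ p - q ∣ ≟ 1) ⊎-dec (∣ p - q ∣ ≟ 4)

C₅-sym : ∀ {p q} → C₅ p q → C₅ q p
C₅-sym {p} {q} = subst (λ d → d ≡ 1 ⊎ d ≡ 4) (∣-∣-comm p q)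

C₅-irrefl : ∀ {p} → ¬ C₅ p p
C₅-irrefl {p} c with ∣ p - p ∣ | ∣n-n∣≡0 p
C₅-irrefl (inj₁ ()) | _ | refl
C₅-irrefl (inj₂ ()) | _ | refl

C₅-triangle-free : ∀ (p q r : Fin 5) →
                   ¬ (C₅ (toℕ p) (toℕ q) × C₅ (toℕ q) (toℕ r) × C₅ (toℕ r) (toℕ p))
C₅-triangle-free = toWitness {a? = all? λ p → all? λ q → all? λ r →
  ¬? (C₅? (toℕ p) (toℕ q) ×-dec C₅? (toℕ q) (toℕ r) ×-dec C₅? (toℕ r) (toℕ p))} _

Bridge : ℕ → ℕ → Set
Bridge p q = (p ≡ 2 × q ≡ 3) ⊎ (q ≡ 2 × p ≡ 3)

Bridge? : ∀ p q → Dec (Bridge p q)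
Bridge? p q = (p ≟ 2 ×-dec q ≟ 3) ⊎-dec (q ≟ 2 ×-dec p ≟ 3)

-- Block p of `sizes` blows up vertex p of C₅. Across the edge {2, 3}, which joins the two blocks
-- of size z, only the pairs with (i + j) mod z < k are adjacent.
module C₅-Blowup (k x z : ℕ) .{{_ : NonZero z}} (x+z≡2k : x + z ≡ 2 * k) (k≤z : k ≤ z) where

  sizes : List ℕ
  sizes = x ∷ k ∷ z ∷ z ∷ k ∷ []

  infix 4 _~ᴮ_ _~ᴮ?_
  _~ᴮ_ : ℕ × ℕ → ℕ × ℕ → Set
  (p , i) ~ᴮ (q , j) = C₅ p q × (Bridge p q → (i + j) % z < k)

  _~ᴮ?_ : ∀ w w′ → Dec (w ~ᴮ w′)
  (p , i) ~ᴮ? (q , j) = C₅? p q ×-dec (Bridge? p q →-dec (i + j) % z <? k)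

  ~ᴮ-sym : ∀ {w w′} → w ~ᴮ w′ → w′ ~ᴮ w
  ~ᴮ-sym {p , i} {q , j} (c , bridge) =
    C₅-sym {p} c , λ b → subst (λ s → s % z < k) (+-comm i j) (bridge (⊎-swap b))

  bridge-degree : ∀ {i} → i < z → ∑[ j < z ] 𝟙 (does ((i + j) % z <? k)) ≡ k
  bridge-degree i<z = trans (∑-rotate z (λ t → 𝟙 (does (t <? k))) (<⇒≤ i<z)) (∑-interval 0 k k≤z)

  no-edges : ∀ n → ∑[ _ < n ] 0 ≡ 0
  no-edges n = ∑-zero n λ _ → refl

  all-edges : ∀ n → ∑[ _ < n ] 1 ≡ n
  all-edges n = ∑-ones n λ _ → refl

  sum-≡ : ∀ {ms ns} → Pointwise _≡_ ms ns → sum ms ≡ sum ns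
  sum-≡ = cong sum ∘ Pointwise-≡⇒≡

  x+[z+0]≡2k : x + (z + 0) ≡ 2 * k
  x+[z+0]≡2k = trans (cong (x +_) (+-identityʳ z)) x+z≡2k

  degree-located : ∀ p {i} → i < lookup sizes p →
                   sum (blockSums sizes (λ w → 𝟙 (does ((toℕ p , i) ~ᴮ? w)))) ≡ 2 * k
  degree-located fzero _ =
    sum-≡ (no-edges x ∷ all-edges k ∷ no-edges z ∷ no-edges z ∷ all-edges k ∷ [])
  degree-located (fsuc fzero) _ =
    trans (sum-≡ (all-edges x ∷ no-edges k ∷ all-edges z ∷ no-edges z ∷ no-edges k ∷ [])) x+[z+0]≡2k
  degree-located (fsuc (fsuc fzero)) i<z =
    sum-≡ (no-edges x ∷ all-edges k ∷ no-edges z ∷ bridge-degree i<z ∷ no-edges k ∷ [])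
  degree-located (fsuc (fsuc (fsuc fzero))) i<z =
    sum-≡ (no-edges x ∷ no-edges k ∷ bridge-degree i<z ∷ no-edges z ∷ all-edges k ∷ [])
  degree-located (fsuc (fsuc (fsuc (fsuc fzero)))) _ =
    trans (sum-≡ (all-edges x ∷ no-edges k ∷ no-edges z ∷ all-edges z ∷ no-edges k ∷ [])) x+[z+0]≡2k

  graph : TriangleFreeRegularGraph (sum sizes) (2 * k)
  graph = record
    { _~_           = λ u v → locate sizes u ~ᴮ locate sizes v
    ; _~?_          = λ u v → locate sizes u ~ᴮ? locate sizes v
    ; ~-sym         = λ {u} {v} → ~ᴮ-sym {locate sizes u} {locate sizes v}
    ; ~-irrefl      = λ {u} → C₅-irrefl {proj₁ (locate sizes u)} ∘ proj₁
    ; triangle-free = triangle-free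
    ; regular       = regular
    }
    where
    triangle-free : ∀ {u v w} → u < sum sizes → v < sum sizes → w < sum sizes →
                    locate sizes u ~ᴮ locate sizes v → locate sizes v ~ᴮ locate sizes w →
                    locate sizes w ~ᴮ locate sizes u → ⊥
    triangle-free u< v< w< (uv , _) (vw , _) (wu , _)
      with p , _ , _ , ≡p ← locate-< sizes u<
         | q , _ , _ , ≡q ← locate-< sizes v<
         | r , _ , _ , ≡r ← locate-< sizes w< =
      C₅-triangle-free p q r ( subst₂ C₅ (cong proj₁ ≡p) (cong proj₁ ≡q) uv
                             , subst₂ C₅ (cong proj₁ ≡q) (cong proj₁ ≡r) vw
                             , subst₂ C₅ (cong proj₁ ≡r) (cong proj₁ ≡p) wu)
    regular : ∀ {u} → u < sum sizes → ∑[ v < sum sizes ] 𝟙 (does (locate sizes u ~ᴮ? locate sizes v)) ≡ 2 * k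
    regular u< with p , i , i< , ≡p,i ← locate-< sizes u< rewrite ≡p,i =
      trans (∑-locate sizes (λ w → 𝟙 (does ((toℕ p , i) ~ᴮ? w)))) (degree-located p i<)

-- Circulant graphs

+-≡⇒≤⇔≥ : ∀ {m n o p} → m + n ≡ o + p → m ≤ o ⇔ p ≤ n
+-≡⇒≤⇔≥ {m} {n} {o} {p} eq = mk⇔
  (λ m≤o → +-cancelˡ-≤ o p n (subst (_≤ o + n) eq (+-monoˡ-≤ n m≤o)))
  (λ p≤n → +-cancelʳ-≤ n m o (subst (_≤ o + n) (sym eq) (+-monoʳ-≤ o p≤n)))

triangle-free-if-sorted : ∀ {R : ℕ → ℕ → Set} → (∀ {x y} → R x y → R y x) →
                          (∀ {x y z} → x ≤ y → y ≤ z → R x y → R y z → R x z → ⊥) →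
                          ∀ {x y z} → R x y → R y z → R z x → ⊥
triangle-free-if-sorted sym sorted {x} {y} {z} xy yz zx with ≤-total x y | ≤-total y z | ≤-total x z
... | inj₁ x≤y | inj₁ y≤z | _        = sorted x≤y y≤z xy yz (sym zx)
... | inj₁ x≤y | inj₂ z≤y | inj₁ x≤z = sorted x≤z z≤y (sym zx) (sym yz) xy
... | inj₁ x≤y | inj₂ z≤y | inj₂ z≤x = sorted z≤x x≤y zx xy (sym yz)
... | inj₂ y≤x | inj₁ y≤z | inj₁ x≤z = sorted y≤x x≤z (sym xy) (sym zx) yz
... | inj₂ y≤x | inj₁ y≤z | inj₂ z≤x = sorted y≤z z≤x yz zx (sym xy)
... | inj₂ y≤x | inj₂ z≤y | _        = sorted z≤y y≤x (sym yz) (sym xy) zx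

-- The circulant graph on ℤ_N with jumps ±[d, d + k), written with ∣ u - v ∣ in place of the
-- cyclic distance: c + d + k ≡ 1 + N makes [c, c + k) the reflection N − [d, d + k).
module Circulant (N k d c : ℕ) (c+d+k≡1+N : c + d + k ≡ suc N) (d+k≤c : d + k ≤ c) (N<3d : N < 3 * d) where

  Jump : ℕ → Set
  Jump t = (d ≤ t × t < d + k) ⊎ (c ≤ t × t < c + k)

  Jump? : ∀ t → Dec (Jump t)
  Jump? t = (d ≤ t <? d + k) ⊎-dec (c ≤ t <? c + k)

  d≤c : d ≤ c
  d≤c = ≤-trans (m≤m+n d k) d+k≤c

  0<d : 0 < d
  0<d = n≢0⇒n>0 λ { refl → n≮0 N<3d }

  c+k≤N : c + k ≤ N
  c+k≤N = s≤s⁻¹ (begin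
    suc (c + k)   ≡⟨ +-comm 1 (c + k) ⟩
    c + k + 1     ≤⟨ +-monoʳ-≤ (c + k) 0<d ⟩
    c + k + d     ≡⟨ +-assoc c k d ⟩
    c + (k + d)   ≡⟨ cong (c +_) (+-comm k d) ⟩
    c + (d + k)   ≡⟨ +-assoc c d k ⟨
    c + d + k     ≡⟨ c+d+k≡1+N ⟩
    suc N         ∎)
    where open ≤-Reasoning

  d-window⇔c-window : ∀ {s t} → s + t ≡ N → (d ≤ s × s < d + k) ⇔ (c ≤ t × t < c + k)
  d-window⇔c-window {s} {t} s+t≡N = mk⇔
    (λ (d≤s , s<d+k) → Equivalence.to low s<d+k , Equivalence.to high d≤s)
    (λ (c≤t , t<c+k) → Equivalence.from high t<c+k , Equivalence.from low c≤t)
    where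
    open ≡-Reasoning
    high : d ≤ s ⇔ suc t ≤ c + k
    high = +-≡⇒≤⇔≥ (begin
      d + (c + k) ≡⟨ +-assoc d c k ⟨
      d + c + k   ≡⟨ cong (_+ k) (+-comm d c) ⟩
      c + d + k   ≡⟨ c+d+k≡1+N ⟩
      suc N       ≡⟨ cong suc s+t≡N ⟨
      suc (s + t) ≡⟨ +-suc s t ⟨
      s + suc t   ∎)
    low : suc s ≤ d + k ⇔ c ≤ t
    low = +-≡⇒≤⇔≥ (begin
      suc (s + t) ≡⟨ cong suc s+t≡N ⟩
      suc N       ≡⟨ c+d+k≡1+N ⟨
      c + d + k   ≡⟨ +-assoc c d k ⟩
      c + (d + k) ≡⟨ +-comm c (d + k) ⟩
      d + k + c   ∎)

  Jump-reflect : ∀ {s t} → s + t ≡ N → Jump s → Jump t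
  Jump-reflect s+t≡N (inj₁ s∈d) = inj₂ (Equivalence.to (d-window⇔c-window s+t≡N) s∈d)
  Jump-reflect {s} {t} s+t≡N (inj₂ s∈c) =
    inj₁ (Equivalence.from (d-window⇔c-window (trans (+-comm t s) s+t≡N)) s∈c)

  Jump⇒far : ∀ {t} → Jump t → d ≤ t × t + d ≤ N
  Jump⇒far {t} j = lower j , s≤s⁻¹ (subst (suc (t + d) ≤_) c+d+k≡1+N (upper j))
    where
    lower : Jump t → d ≤ t
    lower (inj₁ (d≤t , _)) = d≤t
    lower (inj₂ (c≤t , _)) = ≤-trans d≤c c≤t
    upper : Jump t → t + d < c + d + k
    upper (inj₁ (_ , t<d+k)) = <-≤-trans (+-monoˡ-< d (<-≤-trans t<d+k d+k≤c)) (m≤m+n (c + d) k)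
    upper (inj₂ (_ , t<c+k)) =
      subst (t + d <_) (trans (+-assoc c k d) (trans (cong (c +_) (+-comm k d)) (sym (+-assoc c d k))))
            (+-monoˡ-< d t<c+k)

  infix 4 _~_
  _~_ : ℕ → ℕ → Set
  u ~ v = Jump ∣ u - v ∣

  ~-sym : ∀ {u v} → u ~ v → v ~ u
  ~-sym {u} {v} = subst Jump (∣-∣-comm u v)

  no-sorted-triangle : ∀ {x y z} → x ≤ y → y ≤ z → x ~ y → y ~ z → x ~ z → ⊥
  no-sorted-triangle {x} x≤y y≤z xy yz xz
    with s , refl ← m≤n⇒∃[o]m+o≡n x≤y | t , refl ← m≤n⇒∃[o]m+o≡n y≤z = <⇒≱ N<3d (begin
      3 * d     ≡⟨ 3*d≡d+d+d d ⟩
      d + d + d ≤⟨ +-monoˡ-≤ d (+-mono-≤ d≤s d≤t) ⟩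
      s + t + d ≤⟨ s+t+d≤N ⟩
      N         ∎)
    where
    open ≤-Reasoning
    3*d≡d+d+d : ∀ d → 3 * d ≡ d + d + d
    3*d≡d+d+d = solve-∀
    d≤s = proj₁ (Jump⇒far (subst Jump (∣m-m+n∣≡n x s) xy))
    d≤t = proj₁ (Jump⇒far (subst Jump (∣m-m+n∣≡n (x + s) t) yz))
    s+t+d≤N = proj₂ (Jump⇒far (subst Jump (trans (cong (∣ x -_∣) (+-assoc x s t)) (∣m-m+n∣≡n x (s + t))) xz))

  graph : TriangleFreeRegularGraph N (2 * k)
  graph = record
    { _~_           = _~_
    ; _~?_          = λ u v → Jump? ∣ u - v ∣
    ; ~-sym         = λ {u} {v} → ~-sym {u} {v}
    ; ~-irrefl      = λ {u} u~u → <⇒≱ 0<d (proj₁ (Jump⇒far (subst Jump (∣n-n∣≡0 u) u~u)))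
    ; triangle-free = λ {u} {v} {w} _ _ _ →
        triangle-free-if-sorted {R = _~_} (λ {x} {y} → ~-sym {x} {y}) no-sorted-triangle {u} {v} {w}
    ; regular       = regular
    }
    where
    regular : ∀ {u} → u < N → ∑[ v < N ] 𝟙 (does (Jump? ∣ u - v ∣)) ≡ 2 * k
    regular {u} u<N = begin
      ∑[ v < N ] 𝟙 (does (Jump? ∣ u - v ∣))
        ≡⟨ ∑-reflect u (𝟙 ∘ does ∘ Jump?) (<⇒≤ u<N) (λ {s} {t} s+t≡N → cong 𝟙 (does-⇔
             (mk⇔ (Jump-reflect s+t≡N) (Jump-reflect (trans (+-comm t s) s+t≡N))) (Jump? s) (Jump? t))) ⟩
      ∑[ t < N ] 𝟙 (does (Jump? t))
        ≡⟨ ∑-cong N (λ {t} _ → 𝟙-⊎ (d ≤ t <? d + k) (c ≤ t <? c + k)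
             λ ((_ , t<d+k) , (c≤t , _)) → <⇒≱ (<-≤-trans t<d+k d+k≤c) c≤t) ⟩
      ∑[ t < N ] (𝟙 (does (d ≤ t <? d + k)) + 𝟙 (does (c ≤ t <? c + k)))
        ≡⟨ ∑-+ N _ _ ⟩
      ∑[ t < N ] 𝟙 (does (d ≤ t <? d + k)) + ∑[ t < N ] 𝟙 (does (c ≤ t <? c + k))
        ≡⟨ cong₂ _+_ (∑-interval d k (≤-trans d+k≤c (≤-trans (m≤m+n c k) c+k≤N)))
                     (∑-interval c k c+k≤N) ⟩
      k + k
        ≡⟨ cong (k +_) (+-identityʳ k) ⟨
      2 * k ∎
      where open ≡-Reasoning

-- Triangle-free 2k-regular graphs on N ≥ 5k vertices

blowup-parameters : ∀ {k N} → 5 * k ≤ N → N ≤ 6 * k →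
                    ∃₂ λ x z → x + z ≡ 2 * k × k ≤ z × x + (k + (z + (z + (k + 0)))) ≡ N
blowup-parameters {k} 5k≤N N≤6k with w , refl ← m≤n⇒∃[o]m+o≡n 5k≤N
  with x , refl ← m≤n⇒∃[o]m+o≡n (+-cancelˡ-≤ (5 * k) w k (subst (5 * k + w ≤_) (+-comm k (5 * k)) N≤6k)) =
  x , w + x + w , x+z≡2k w x , m≤m+n (w + x) w , size w x
  where
  x+z≡2k : ∀ w x → x + (w + x + w) ≡ 2 * (w + x)
  x+z≡2k = solve-∀
  size : ∀ w x → x + ((w + x) + ((w + x + w) + ((w + x + w) + ((w + x) + 0)))) ≡ 5 * (w + x) + w
  size = solve-∀

circulant-parameters : ∀ {k N} → 6 * k < N → ∃₂ λ d c → c + d + k ≡ suc N × d + k ≤ c × N < 3 * d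
circulant-parameters {k} 6k<N with r , refl ← m≤n⇒∃[o]m+o≡n 6k<N =
  d , d + k + r % 2 , size , m≤m+n (d + k) (r % 2) , N<3d
  where
  open ≤-Reasoning
  d : ℕ
  d = 2 * k + 1 + r / 2
  r≡ : r ≡ r % 2 + r / 2 * 2
  r≡ = m≡m%n+[m/n]*n r 2
  size : d + k + r % 2 + d + k ≡ suc (suc (6 * k) + r)
  size = trans (e k (r / 2) (r % 2)) (cong (λ r → suc (suc (6 * k) + r)) (sym r≡))
    where
    e : ∀ k s e → (2 * k + 1 + s) + k + e + (2 * k + 1 + s) + k ≡ suc (suc (6 * k) + (e + s * 2))
    e = solve-∀
  N<3d : suc (6 * k) + r < 3 * d
  N<3d = begin-strict
    suc (6 * k) + r                             ≡⟨ cong (suc (6 * k) +_) r≡ ⟩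
    suc (6 * k) + (r % 2 + r / 2 * 2)           ≤⟨ +-monoʳ-≤ (suc (6 * k))
                                                     (+-monoˡ-≤ (r / 2 * 2) (s≤s⁻¹ (m%n<n r 2))) ⟩
    suc (6 * k) + (1 + r / 2 * 2)               <⟨ n<1+n _ ⟩
    suc (suc (6 * k) + (1 + r / 2 * 2))         ≤⟨ m≤m+n _ (r / 2) ⟩
    suc (suc (6 * k) + (1 + r / 2 * 2)) + r / 2 ≡⟨ e k (r / 2) ⟩
    3 * d                                       ∎
    where
    e : ∀ k s → suc (suc (6 * k) + (1 + s * 2)) + s ≡ 3 * (2 * k + 1 + s)
    e = solve-∀

triangle-free-regular : ∀ {k N} → 0 < k → 5 * k ≤ N → TriangleFreeRegularGraph N (2 * k)
triangle-free-regular {k} {N} 0<k 5k≤N with N ≤? 6 * k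
... | yes N≤6k with x , z , x+z≡2k , k≤z , size ← blowup-parameters 5k≤N N≤6k =
  subst (λ n → TriangleFreeRegularGraph n (2 * k)) size
        (C₅-Blowup.graph k x z {{>-nonZero (<-≤-trans 0<k k≤z)}} x+z≡2k k≤z)
... | no N≰6k with d , c , c+d+k≡1+N , d+k≤c , N<3d ← circulant-parameters (≰⇒> N≰6k) =
  Circulant.graph N k d c c+d+k≡1+N d+k≤c N<3d

3[2k]<2b+4⇒5k≤2k+b+1 : ∀ k b → 3 * (k * 2) < 2 * b + 4 → 5 * k ≤ k * 2 + b + 1
3[2k]<2b+4⇒5k≤2k+b+1 k b 3a<2b+4 = begin
  5 * k           ≡⟨ e₃ k ⟩
  k * 2 + 3 * k   ≤⟨ +-monoʳ-≤ (k * 2) (s≤s⁻¹ 3k<2+b) ⟩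
  k * 2 + suc b   ≡⟨ +-suc (k * 2) b ⟩
  suc (k * 2 + b) ≡⟨ +-comm 1 (k * 2 + b) ⟩
  k * 2 + b + 1   ∎
  where
  open ≤-Reasoning
  e₁ : ∀ k → 3 * (k * 2) ≡ 2 * (3 * k)
  e₁ = solve-∀
  e₂ : ∀ b → 2 * b + 4 ≡ 2 * (2 + b)
  e₂ = solve-∀
  e₃ : ∀ k → 5 * k ≡ k * 2 + 3 * k
  e₃ = solve-∀
  3k<2+b : 3 * k < 2 + b
  3k<2+b = *-cancelˡ-< 2 (3 * k) (2 + b) (subst₂ _<_ (e₁ k) (e₂ b) 3a<2b+4)

lemma13 : (a b : ℕ) → 3 ≤ a → a ≤ b → 2 ∣ a → 3 * a < 2 * b + 4 →
    MinOrder a b 4 (a + b + 1)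
lemma13 a b 3≤a _ (divides k refl) 3a<2b+4 =
  Complement.abg-wgraph Γ (≤-trans (n≤1+n 2) 3≤a) , λ _ → IsABGWGraph⇒a+b+1≤n
  where
  0<k : 0 < k
  0<k = *-cancelʳ-< 2 0 k (≤-trans (s≤s z≤n) 3≤a)
  Γ : TriangleFreeRegularGraph (k * 2 + b + 1) (k * 2)
  Γ = subst (TriangleFreeRegularGraph _) (*-comm 2 k)
            (triangle-free-regular 0<k (3[2k]<2b+4⇒5k≤2k+b+1 k b 3a<2b+4))
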